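{- Let $\mu=(\mathrm{Val},(\mathcal P,\mathcal O),\varsigma)$ be a model for the predicate symbols $\mathrm{broadcast},\mathrm{echo},\mathrm{ready},\mathrm{deliver}$ whose semitopology $(\mathcal P,\mathcal O)$ is 3-twined, and suppose every axiom of the theory $\mathrm{ThyBB}$ is valid in $\mu$. Then for every $v\in\mathrm{Val}$, $$\models \mathsf{Somewhere}\,\mathrm{broadcast}(v)\ \to_w\ \mathsf{Everywhere}\,\mathrm{deliver}(v).$$
   Context: Truth values: $\mathbf 3=\{\mathbf f,\mathbf b,\mathbf t\}$ totally ordered by $\mathbf f<\mathbf b<\mathbf t$; $\wedge,\vee$ are min and max, $\bigwedge,\bigvee$ are infimum and supremum. Negation: $\neg\mathbf t=\mathbf f$, $\neg\mathbf b=\mathbf b$, $\neg\mathbf f=\mathbf t$. Modalities: $\mathsf T x=\mathbf t$ if $x=\mathbf t$, else $\mathbf f$; $\mathsf B x=\mathbf t$ if $x=\mathbf b$, else $\mathbf f$; $\mathsf{TF}x=\mathbf t$ if $x\in\{\mathbf t,\mathbf f\}$, else $\mathbf f$. Weak implication: $x\to_w y:=\neg x\vee y$. A truth value is valid iff it lies in $\{\mathbf t,\mathbf b\}$. A semitopology $(\mathcal P,\mathcal O)$ is a set $\mathcal P$ with a family $\mathcal O$ of subsets containing $\mathcal P$ and closed under arbitrary (including empty) unions; $\mathcal O^{\neq\emptyset}$ is the set of nonempty members of $\mathcal O$. It is 3-twined if any three members of $\mathcal O^{\neq\emptyset}$ have nonempty intersection. For $f:\mathcal P\to\mathbf 3$: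 $\mathsf{Everywhere} f=\bigwedge_{p}f(p)$, $\mathsf{Somewhere} f=\bigvee_p f(p)$, $\mathsf{Quorum} f=\bigvee_{O\in\mathcal O^{\neq\emptyset}}\bigwedge_{p\in O}f(p)$, $\mathsf{Contraquorum} f=\bigwedge_{O\in\mathcal O^{\neq\emptyset}}\bigvee_{p\in O}f(p)$. Logic: a model $\mu=(\mathrm{Val},(\mathcal P,\mathcal O),\varsigma)$ consists of a nonempty set $\mathrm{Val}$, a semitopology, and for each predicate symbol $R$ a function $\varsigma(R):\mathcal P\to\mathrm{Val}\to\mathbf 3$. Formulas are built from atoms $R(t)$ ($t$ a value or a variable ranging over $\mathrm{Val}$), value equalities $v\doteq v'$ (denoting $\mathbf t$ if $v=v'$ and $\mathbf f$ otherwise), the connectives $\neg,\wedge,\vee,\to_w$, the modalities $\mathsf T,\mathsf B,\mathsf{TF}$, the operators $\mathsf{Everywhere},\mathsf{Somewhere},\mathsf{Quorum},\mathsf{Contraquorum}$ and quantifiers over $\mathrm{Val}$. The denotation $[\![\phi]\!]:\mathcal P\to\mathbf 3$ of a closed formula is: $[\![R(v)]\!](p)=\varsigma(R)(p)(v)$; connectives and $\mathsf T,\mathsf B,\mathsf{TF}$ act pointwise in $p$; $[\![\mathsf{Quorum}\,\phi]\!](p)=\mathsf{Quorum}([\![\phi]\!])$ for every $p$, and likewise for $\mathsf{Contraquorum},\mathsf{Everywhere},\mathsf{Somewhere}$; $[\![\exists a.\phi]\!](p)=\bigvee_{v\in\mathrm{Val}}[\![\phi[a:=v]]\!](p)$,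 $[\![\forall a.\phi]\!](p)=\bigwedge_{v}[\![\phi[a:=v]]\!](p)$; $[\![\exists_{01}a.\phi]\!](p)=\bigwedge_{v,v'\in\mathrm{Val}}\big(([\![\phi[a:=v]]\!](p)\wedge[\![\phi[a:=v']]\!](p))\to_w (v\doteq v')\big)$; $\exists_1 a.\phi:=(\exists_{01}a.\phi)\wedge(\exists a.\phi)$. Write $p\models\phi$ iff $[\![\phi]\!](p)\in\{\mathbf t,\mathbf b\}$, and $\models\phi$ iff $p\models\phi$ for all $p\in\mathcal P$. For a predicate symbol $R$: $\mathrm{correct}(R):=\forall a.\mathsf{TF}R(a)$ and $\mathrm{incorrect}(R):=\forall a.\mathsf B R(a)$. An axiom containing a free variable $a$ is read as universally quantified over $a$. An axiom is valid in $\mu$ if $\models$ it. The theory $\mathrm{ThyBB}$ (predicate symbols $\mathrm{broadcast},\mathrm{echo},\mathrm{ready},\mathrm{deliver}$) consists of: BrDeliver?: $\mathrm{deliver}(a)\to_w\mathsf{Quorum}\,\mathrm{ready}(a)$; BrReady?: $\mathrm{ready}(a)\to_w\mathsf{Quorum}\,\mathrm{echo}(a)$; BrEcho?: $\mathrm{echo}(a)\to_w\mathsf{Somewhere}\,\mathrm{broadcast}(a)$; BrEcho01: $\exists_{01}a.\mathrm{echo}(a)$; BrBroadcast1: $\exists_1 a.\mathsf{Somewhere}\,\mathrm{broadcast}(a)$; BrDeliver!: $\mathsf{Quorum}\,\mathrm{ready}(a)\to_w\mathrm{deliver}(a)$; BrReady!: $\mathsf{Quorum}\,\mathrm{echo}(a)\to_w\mathrm{ready}(a)$;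 BrEcho!: $\mathsf{Somewhere}\,\mathrm{broadcast}(a)\to_w\exists a.\mathrm{echo}(a)$; BrReady!!: $\mathsf{Contraquorum}\,\mathrm{ready}(a)\to_w\mathrm{ready}(a)$; BrCorrect: $\mathsf{Quorum}\,\mathrm{correct}(\mathrm{ready})\wedge\mathsf{Quorum}\,\mathrm{correct}(\mathrm{echo})$; BrCorrect': $\mathrm{correct}(R)\vee\mathrm{incorrect}(R)$ for $R\in\{\mathrm{ready},\mathrm{echo}\}$; BrCorrect'': $\mathsf{Everywhere}\,\mathrm{correct}(\mathrm{broadcast})\vee\mathsf{Everywhere}\,\mathrm{incorrect}(\mathrm{broadcast})$. -}

module Defs where

open import Level using (Level; _⊔_; 0ℓ; Lift) renaming (suc to lsuc)
open import Data.Unit using (⊤)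
open import Data.Product using (Σ; Σ-syntax; ∃; ∃-syntax; _×_; _,_; proj₁; proj₂)
open import Data.Sum using (_⊎_)
open import Relation.Binary.PropositionalEquality using (_≡_; _≢_)

data 𝟛 : Set where
  𝐟 𝐛 𝐭 : 𝟛

data _≤₃_ : 𝟛 → 𝟛 → Set where
  f≤  : ∀ {x} → 𝐟 ≤₃ x
  b≤b : 𝐛 ≤₃ 𝐛
  b≤t : 𝐛 ≤₃ 𝐭
  t≤t : 𝐭 ≤₃ 𝐭

_∧₃_ : 𝟛 → 𝟛 → 𝟛
𝐟 ∧₃ y = 𝐟
𝐛 ∧₃ 𝐟 = 𝐟
𝐛 ∧₃ 𝐛 = 𝐛
𝐛 ∧₃ 𝐭 = 𝐛
𝐭 ∧₃ y = y

_∨₃_ : 𝟛 → 𝟛 → 𝟛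
𝐟 ∨₃ y = y
𝐛 ∨₃ 𝐟 = 𝐛
𝐛 ∨₃ 𝐛 = 𝐛
𝐛 ∨₃ 𝐭 = 𝐭
𝐭 ∨₃ y = 𝐭

¬₃_ : 𝟛 → 𝟛
¬₃ 𝐭 = 𝐟
¬₃ 𝐛 = 𝐛
¬₃ 𝐟 = 𝐭

_→w_ : 𝟛 → 𝟛 → 𝟛
x →w y = (¬₃ x) ∨₃ y

T₃ : 𝟛 → 𝟛
T₃ 𝐭 = 𝐭
T₃ _ = 𝐟

B₃ : 𝟛 → 𝟛
B₃ 𝐛 = 𝐭
B₃ _ = 𝐟

TF₃ : 𝟛 → 𝟛
TF₃ 𝐛 = 𝐟
TF₃ _ = 𝐭

Valid : 𝟛 → Set
Valid x = (x ≡ 𝐭) ⊎ (x ≡ 𝐛)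

-- "x is the infimum / supremum of the family g" (arbitrary index set).
-- In classical mathematics these always exist and are unique in 3.
IsInf : ∀ {ℓ} {A : Set ℓ} → (A → 𝟛) → 𝟛 → Set ℓ
IsInf {A = A} g x = (∀ i → x ≤₃ g i) × (∀ y → (∀ i → y ≤₃ g i) → y ≤₃ x)

IsSup : ∀ {ℓ} {A : Set ℓ} → (A → 𝟛) → 𝟛 → Set ℓ
IsSup {A = A} g x = (∀ i → g i ≤₃ x) × (∀ y → (∀ i → g i ≤₃ y) → x ≤₃ y)

record Semitopology : Set₂ where
  field
    Pt        : Set
    Open      : (Pt → Set) → Set
    open-all  : Open (λ _ → ⊤)
    open-⋃    : (I : Set) (U : I → Pt → Set) →
                (∀ i → Open (U i)) → Open (λ p → Σ I (λ i → U i p))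

  NEOpen : Set₁
  NEOpen = Σ (Pt → Set) (λ O → Open O × Σ Pt O)

  Mem : NEOpen → Set
  Mem (O , _) = Σ Pt O

  pt : {O : NEOpen} → Mem O → Pt
  pt = proj₁

open Semitopology public

ThreeTwined : Semitopology → Set₁
ThreeTwined S = (O₁ O₂ O₃ : Pt S → Set) →
  Open S O₁ → Open S O₂ → Open S O₃ →
  Σ (Pt S) O₁ → Σ (Pt S) O₂ → Σ (Pt S) O₃ →
  Σ (Pt S) (λ p → O₁ p × O₂ p × O₃ p)

data Sym : Set where
  broadcast echo ready deliver : Sym

-- Binders are represented by Agda
-- functions Val → Formula (so substitution φ[a:=v] is application).
-- Terms are values; a variable bound by a quantifier is the bound
-- argument of the function.

data Formula (Val : Set) : Set where
  atom         : Sym → Val → Formula Val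
  _≐_          : Val → Val → Formula Val
  ¬'_          : Formula Val → Formula Val
  _∧'_ _∨'_ _→w'_ : Formula Val → Formula Val → Formula Val
  T' B' TF'    : Formula Val → Formula Val
  Everywhere Somewhere Quorum Contraquorum : Formula Val → Formula Val
  ∀' ∃' ∃01'   : (Val → Formula Val) → Formula Val

∃1' : ∀ {Val} → (Val → Formula Val) → Formula Val
∃1' φ = ∃01' φ ∧' ∃' φ

record Model : Set₂ where
  field
    Val  : Set
    val₀ : Val
    top  : Semitopology
    ς    : Sym → Pt top → Val → 𝟛

open Model public

Lift₁ : Set → Set₁
Lift₁ A = Lift (lsuc 0ℓ) A

-- Denotation, as a relation:  Den μ φ p x  means  [[φ]](p) = x.
module _ (μ : Model) where
  private
    S = top μ
    P = Pt S
    V = Val μ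

  EqVal : V → V → 𝟛 → Set
  EqVal v v' x = (v ≡ v' × x ≡ 𝐭) ⊎ ((v ≢ v') × x ≡ 𝐟)

  Den : Formula V → P → 𝟛 → Set₁
  Den (atom R v) p x = Lift₁ (ς μ R p v ≡ x)
  Den (v ≐ v') p x = Lift₁ (EqVal v v' x)
  Den (¬' φ) p x = Σ 𝟛 λ y → Den φ p y × Lift₁ (x ≡ ¬₃ y)
  Den (φ ∧' ψ) p x = Σ 𝟛 λ y → Σ 𝟛 λ z → Den φ p y × Den ψ p z × Lift₁ (x ≡ y ∧₃ z)
  Den (φ ∨' ψ) p x = Σ 𝟛 λ y → Σ 𝟛 λ z → Den φ p y × Den ψ p z × Lift₁ (x ≡ y ∨₃ z)
  Den (φ →w' ψ) p x = Σ 𝟛 λ y → Σ 𝟛 λ z → Den φ p y × Den ψ p z × Lift₁ (x ≡ y →w z)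
  Den (T' φ) p x = Σ 𝟛 λ y → Den φ p y × Lift₁ (x ≡ T₃ y)
  Den (B' φ) p x = Σ 𝟛 λ y → Den φ p y × Lift₁ (x ≡ B₃ y)
  Den (TF' φ) p x = Σ 𝟛 λ y → Den φ p y × Lift₁ (x ≡ TF₃ y)
  Den (Everywhere φ) p x =
    Σ (P → 𝟛) λ g → (∀ q → Den φ q (g q)) × Lift₁ (IsInf g x)
  Den (Somewhere φ) p x =
    Σ (P → 𝟛) λ g → (∀ q → Den φ q (g q)) × Lift₁ (IsSup g x)
  Den (Quorum φ) p x =
    Σ (P → 𝟛) λ g → (∀ q → Den φ q (g q)) ×
    Σ (NEOpen S → 𝟛) λ h →
      (∀ O → IsInf {A = Mem S O} (λ m → g (pt S {O} m)) (h O)) × IsSup h x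
  Den (Contraquorum φ) p x =
    Σ (P → 𝟛) λ g → (∀ q → Den φ q (g q)) ×
    Σ (NEOpen S → 𝟛) λ h →
      (∀ O → IsSup {A = Mem S O} (λ m → g (pt S {O} m)) (h O)) × IsInf h x
  Den (∀' φ) p x =
    Σ (V → 𝟛) λ g → (∀ v → Den (φ v) p (g v)) × Lift₁ (IsInf g x)
  Den (∃' φ) p x =
    Σ (V → 𝟛) λ g → (∀ v → Den (φ v) p (g v)) × Lift₁ (IsSup g x)
  Den (∃01' φ) p x =
    Σ (V → 𝟛) λ g → (∀ v → Den (φ v) p (g v)) ×
    Σ (V → V → 𝟛) λ e → (∀ v v' → EqVal v v' (e v v')) ×
    Lift₁ (IsInf {A = V × V}
      (λ vv → (g (proj₁ vv) ∧₃ g (proj₂ vv)) →w e (proj₁ vv) (proj₂ vv)) x)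

  _⊨_ : P → Formula V → Set₁
  p ⊨ φ = ∀ x → Den φ p x → Valid x

  ⊨_ : Formula V → Set₁
  ⊨ φ = ∀ p → p ⊨ φ

module _ {Val : Set} where
  correct incorrect : Sym → Formula Val
  correct R   = ∀' (λ a → TF' (atom R a))
  incorrect R = ∀' (λ a → B' (atom R a))

record ThyBB (μ : Model) : Set₁ where
  private V = Val μ
  field
    BrDeliver? : ∀ (a : V) → ⊨_ μ (atom deliver a →w' Quorum (atom ready a))
    BrReady?   : ∀ (a : V) → ⊨_ μ (atom ready a →w' Quorum (atom echo a))
    BrEcho?    : ∀ (a : V) → ⊨_ μ (atom echo a →w' Somewhere (atom broadcast a))
    BrEcho01   : ⊨_ μ (∃01' (λ a → atom echo a))
    BrBroadcast1 : ⊨_ μ (∃1' (λ a → Somewhere (atom broadcast a)))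
    BrDeliver! : ∀ (a : V) → ⊨_ μ (Quorum (atom ready a) →w' atom deliver a)
    BrReady!   : ∀ (a : V) → ⊨_ μ (Quorum (atom echo a) →w' atom ready a)
    BrEcho!    : ∀ (a : V) → ⊨_ μ (Somewhere (atom broadcast a) →w' ∃' (λ a' → atom echo a'))
    BrReady!!  : ∀ (a : V) → ⊨_ μ (Contraquorum (atom ready a) →w' atom ready a)
    BrCorrect  : ⊨_ μ (Quorum (correct ready) ∧' Quorum (correct echo))
    BrCorrect'-ready : ⊨_ μ (correct ready ∨' incorrect ready)
    BrCorrect'-echo  : ⊨_ μ (correct echo ∨' incorrect echo)
    BrCorrect''      : ⊨_ μ (Everywhere (correct broadcast) ∨' Everywhere (incorrect broadcast))

-- Suppose v is broadcast truly somewhere. Broadcast is then correct everywhere, and by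
-- BrBroadcast1 v is the only value broadcast truly anywhere. On the quorum where echo is
-- correct every point therefore echoes truly, and only v: BrEcho! supplies some echoed a,
-- and BrEcho? traces a back to a true broadcast of a, so a = v. That quorum makes
-- Quorum echo(v) true everywhere, so by BrReady! ready(v) is valid everywhere, hence true
-- on the quorum where ready is correct; by BrDeliver! deliver(v) is then valid everywhere.
-- A single quorum suffices at each step.
-- If v is broadcast truly nowhere, Somewhere broadcast(v) is at most b, and any weak
-- implication out of it is valid.

module Submission where

open import Defs
open import Axiom.ExcludedMiddle using (ExcludedMiddle)
open import Level using (0ℓ; lift; lower)
open import Data.Product using (Σ; ∃; _×_; _,_; proj₁; proj₂)
open import Data.Sum using (_⊎_; inj₁; inj₂; [_,_]′)
open import Relation.Nullary using (yes; no; ¬_; contradiction)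
open import Relation.Nullary.Decidable using (map′; toSum)
open import Relation.Binary.PropositionalEquality
  using (_≡_; _≢_; refl; sym; trans; subst; cong; cong₂)

≤₃-trans : ∀ {x y z} → x ≤₃ y → y ≤₃ z → x ≤₃ z
≤₃-trans f≤  _   = f≤
≤₃-trans b≤b q   = q
≤₃-trans b≤t t≤t = b≤t
≤₃-trans t≤t t≤t = t≤t

≤₃-antisym : ∀ {x y} → x ≤₃ y → y ≤₃ x → x ≡ y
≤₃-antisym f≤  f≤  = refl
≤₃-antisym b≤b b≤b = refl
≤₃-antisym t≤t t≤t = refl

x≤₃𝐭 : ∀ x → x ≤₃ 𝐭
x≤₃𝐭 𝐟 = f≤
x≤₃𝐭 𝐛 = b≤t
x≤₃𝐭 𝐭 = t≤t

𝐭≤₃⇒≡𝐭 : ∀ {x} → 𝐭 ≤₃ x → x ≡ 𝐭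
𝐭≤₃⇒≡𝐭 t≤t = refl

≢𝐭⇒≤₃𝐛 : ∀ {x} → x ≢ 𝐭 → x ≤₃ 𝐛
≢𝐭⇒≤₃𝐛 {𝐟} _   = f≤
≢𝐭⇒≤₃𝐛 {𝐛} _   = b≤b
≢𝐭⇒≤₃𝐛 {𝐭} x≢𝐭 = contradiction refl x≢𝐭

≤₃𝐛⇒≢𝐭 : ∀ {x} → x ≤₃ 𝐛 → x ≢ 𝐭
≤₃𝐛⇒≢𝐭 f≤ ()

¬Valid-𝐟 : ¬ Valid 𝐟
¬Valid-𝐟 (inj₁ ())
¬Valid-𝐟 (inj₂ ())

Valid⇒𝐛≤₃ : ∀ {x} → Valid x → 𝐛 ≤₃ x
Valid⇒𝐛≤₃ (inj₁ refl) = b≤t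
Valid⇒𝐛≤₃ (inj₂ refl) = b≤b

𝐛≤₃⇒Valid : ∀ {x} → 𝐛 ≤₃ x → Valid x
𝐛≤₃⇒Valid b≤b = inj₂ refl
𝐛≤₃⇒Valid b≤t = inj₁ refl

¬Valid⇒≤₃𝐟 : ∀ {x} → ¬ Valid x → x ≤₃ 𝐟
¬Valid⇒≤₃𝐟 {𝐟} _  = f≤
¬Valid⇒≤₃𝐟 {𝐛} ¬v = contradiction (inj₂ refl) ¬v
¬Valid⇒≤₃𝐟 {𝐭} ¬v = contradiction (inj₁ refl) ¬v

≢𝐟⇒Valid : ∀ {x} → x ≢ 𝐟 → Valid x
≢𝐟⇒Valid {𝐟} x≢𝐟 = contradiction refl x≢𝐟
≢𝐟⇒Valid {𝐛} _   = inj₂ refl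
≢𝐟⇒Valid {𝐭} _   = inj₁ refl

Valid∧≢𝐛⇒≡𝐭 : ∀ {x} → Valid x → x ≢ 𝐛 → x ≡ 𝐭
Valid∧≢𝐛⇒≡𝐭 (inj₁ x≡𝐭) _   = x≡𝐭
Valid∧≢𝐛⇒≡𝐭 (inj₂ x≡𝐛) x≢𝐛 = contradiction x≡𝐛 x≢𝐛

Valid-∨⁻ : ∀ x y → Valid (x ∨₃ y) → Valid x ⊎ Valid y
Valid-∨⁻ 𝐟 _ v = inj₂ v
Valid-∨⁻ 𝐛 _ _ = inj₁ (inj₂ refl)
Valid-∨⁻ 𝐭 _ _ = inj₁ (inj₁ refl)

Valid-∧⁻ : ∀ x y → Valid (x ∧₃ y) → Valid x × Valid y
Valid-∧⁻ 𝐟 _ v = contradiction v ¬Valid-𝐟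
Valid-∧⁻ 𝐛 𝐟 v = contradiction v ¬Valid-𝐟
Valid-∧⁻ 𝐛 𝐛 _ = inj₂ refl , inj₂ refl
Valid-∧⁻ 𝐛 𝐭 _ = inj₂ refl , inj₁ refl
Valid-∧⁻ 𝐭 _ v = inj₁ refl , v

Valid-→w-mp : ∀ {x y} → x ≡ 𝐭 → Valid (x →w y) → Valid y
Valid-→w-mp refl v = v

Valid-→w-antecedent : ∀ {x} y → x ≢ 𝐭 → Valid (x →w y)
Valid-→w-antecedent {𝐟} _ _   = inj₁ refl
Valid-→w-antecedent {𝐛} 𝐟 _   = inj₂ refl
Valid-→w-antecedent {𝐛} 𝐛 _   = inj₂ refl
Valid-→w-antecedent {𝐛} 𝐭 _   = inj₁ refl
Valid-→w-antecedent {𝐭} _ x≢𝐭 = contradiction refl x≢𝐭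

Valid-→w-consequent : ∀ x {y} → Valid y → Valid (x →w y)
Valid-→w-consequent 𝐟     _ = inj₁ refl
Valid-→w-consequent 𝐛 {y} _ = Valid-→w-antecedent y (λ ())
Valid-→w-consequent 𝐭     v = v

Valid-TF₃⁻ : ∀ x → Valid (TF₃ x) → x ≢ 𝐛
Valid-TF₃⁻ 𝐛 v refl = ¬Valid-𝐟 v

Valid-B₃⁻ : ∀ x → Valid (B₃ x) → x ≡ 𝐛
Valid-B₃⁻ 𝐟 v = contradiction v ¬Valid-𝐟
Valid-B₃⁻ 𝐛 _ = refl
Valid-B₃⁻ 𝐭 v = contradiction v ¬Valid-𝐟

module _ {ℓ} {A : Set ℓ} {g : A → 𝟛} {x : 𝟛} where

  IsSup-𝐭 : IsSup g x → ∀ i → g i ≡ 𝐭 → x ≡ 𝐭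
  IsSup-𝐭 (ub , _) i gi≡𝐭 = 𝐭≤₃⇒≡𝐭 (subst (_≤₃ x) gi≡𝐭 (ub i))

  IsSup-≢𝐭 : IsSup g x → (∀ i → g i ≢ 𝐭) → x ≢ 𝐭
  IsSup-≢𝐭 (_ , least) ¬𝐭 = ≤₃𝐛⇒≢𝐭 (least 𝐛 (λ i → ≢𝐭⇒≤₃𝐛 (¬𝐭 i)))

  IsSup-¬Valid : IsSup g x → (∀ i → ¬ Valid (g i)) → ¬ Valid x
  IsSup-¬Valid (_ , least) ¬v v =
    ¬Valid-𝐟 (𝐛≤₃⇒Valid (≤₃-trans (Valid⇒𝐛≤₃ v) (least 𝐟 (λ i → ¬Valid⇒≤₃𝐟 (¬v i)))))

  IsInf-𝐭 : IsInf g x → (∀ i → g i ≡ 𝐭) → x ≡ 𝐭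
  IsInf-𝐭 (_ , greatest) all𝐭 = 𝐭≤₃⇒≡𝐭 (greatest 𝐭 (λ i → subst (𝐭 ≤₃_) (sym (all𝐭 i)) t≤t))

  IsInf-Valid : IsInf g x → (∀ i → Valid (g i)) → Valid x
  IsInf-Valid (_ , greatest) allValid = 𝐛≤₃⇒Valid (greatest 𝐛 (λ i → Valid⇒𝐛≤₃ (allValid i)))

  IsInf-Valid⁻ : IsInf g x → Valid x → ∀ i → Valid (g i)
  IsInf-Valid⁻ (lb , _) v i = 𝐛≤₃⇒Valid (≤₃-trans (Valid⇒𝐛≤₃ v) (lb i))

module _ {ℓ} {A : Set ℓ} {g h : A → 𝟛} {x y : 𝟛} where

  IsSup-unique : (∀ i → g i ≡ h i) → IsSup g x → IsSup h y → x ≡ y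
  IsSup-unique g≗h (ubg , leastg) (ubh , leasth) = ≤₃-antisym
    (leastg y (λ i → subst (_≤₃ y) (sym (g≗h i)) (ubh i)))
    (leasth x (λ i → subst (_≤₃ x) (g≗h i) (ubg i)))

  IsInf-unique : (∀ i → g i ≡ h i) → IsInf g x → IsInf h y → x ≡ y
  IsInf-unique g≗h (lbg , greatestg) (lbh , greatesth) = ≤₃-antisym
    (greatesth x (λ i → subst (x ≤₃_) (g≗h i) (lbg i)))
    (greatestg y (λ i → subst (y ≤₃_) (sym (g≗h i)) (lbh i)))

em-lower : ∀ {ℓ} → ExcludedMiddle (Level.suc ℓ) → ExcludedMiddle ℓ
em-lower em = map′ lower lift em

module _ {ℓ} (em : ExcludedMiddle ℓ) {A : Set ℓ} where

  ⋁ : (A → 𝟛) → 𝟛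
  ⋁ g with em {∃ λ i → g i ≡ 𝐭} | em {∃ λ i → g i ≡ 𝐛}
  ... | yes _ | _     = 𝐭
  ... | no _  | yes _ = 𝐛
  ... | no _  | no _  = 𝐟

  ⋁-IsSup : ∀ g → IsSup g (⋁ g)
  ⋁-IsSup g with em {∃ λ i → g i ≡ 𝐭} | em {∃ λ i → g i ≡ 𝐛}
  ... | yes (i , gi≡𝐭) | _ =
    (λ j → x≤₃𝐭 (g j)) , λ y ub → subst (_≤₃ y) gi≡𝐭 (ub i)
  ... | no ¬𝐭 | yes (i , gi≡𝐛) =
    (λ j → ≢𝐭⇒≤₃𝐛 (λ gj≡𝐭 → ¬𝐭 (j , gj≡𝐭))) , λ y ub → subst (_≤₃ y) gi≡𝐛 (ub i)
  ... | no ¬𝐭 | no ¬𝐛 = (λ j → ¬Valid⇒≤₃𝐟 (neither j)) , λ _ _ → f≤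
    where
    neither : ∀ j → ¬ Valid (g j)
    neither j (inj₁ gj≡𝐭) = ¬𝐭 (j , gj≡𝐭)
    neither j (inj₂ gj≡𝐛) = ¬𝐛 (j , gj≡𝐛)

  ⋀ : (A → 𝟛) → 𝟛
  ⋀ g with em {∃ λ i → g i ≡ 𝐟} | em {∃ λ i → g i ≡ 𝐛}
  ... | yes _ | _     = 𝐟
  ... | no _  | yes _ = 𝐛
  ... | no _  | no _  = 𝐭

  ⋀-IsInf : ∀ g → IsInf g (⋀ g)
  ⋀-IsInf g with em {∃ λ i → g i ≡ 𝐟} | em {∃ λ i → g i ≡ 𝐛}
  ... | yes (i , gi≡𝐟) | _ =
    (λ _ → f≤) , λ y lb → subst (y ≤₃_) gi≡𝐟 (lb i)
  ... | no ¬𝐟 | yes (i , gi≡𝐛) =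
    (λ j → Valid⇒𝐛≤₃ (≢𝐟⇒Valid (λ gj≡𝐟 → ¬𝐟 (j , gj≡𝐟)))) , λ y lb → subst (y ≤₃_) gi≡𝐛 (lb i)
  ... | no ¬𝐟 | no ¬𝐛 = (λ j → subst (𝐭 ≤₃_) (sym (true j)) t≤t) , λ y _ → x≤₃𝐭 y
    where
    true : ∀ j → g j ≡ 𝐭
    true j = Valid∧≢𝐛⇒≡𝐭 (≢𝐟⇒Valid (λ gj≡𝐟 → ¬𝐟 (j , gj≡𝐟))) (λ gj≡𝐛 → ¬𝐛 (j , gj≡𝐛))

  ⋁-𝐭 : ∀ {g} i → g i ≡ 𝐭 → ⋁ g ≡ 𝐭
  ⋁-𝐭 {g} = IsSup-𝐭 (⋁-IsSup g)

  ⋁-≢𝐭 : ∀ {g} → (∀ i → g i ≢ 𝐭) → ⋁ g ≢ 𝐭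
  ⋁-≢𝐭 {g} = IsSup-≢𝐭 (⋁-IsSup g)

  ⋁-Valid⁻ : ∀ {g} → Valid (⋁ g) → ∃ λ i → Valid (g i)
  ⋁-Valid⁻ {g} v with em {∃ λ i → Valid (g i)}
  ... | yes witness = witness
  ... | no ¬witness = contradiction v (IsSup-¬Valid (⋁-IsSup g) (λ i vi → ¬witness (i , vi)))

  ⋀-𝐭 : ∀ {g} → (∀ i → g i ≡ 𝐭) → ⋀ g ≡ 𝐭
  ⋀-𝐭 {g} = IsInf-𝐭 (⋀-IsInf g)

  ⋀-Valid : ∀ {g} → (∀ i → Valid (g i)) → Valid (⋀ g)
  ⋀-Valid {g} = IsInf-Valid (⋀-IsInf g)

  ⋀-Valid⁻ : ∀ {g} → Valid (⋀ g) → ∀ i → Valid (g i)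
  ⋀-Valid⁻ {g} = IsInf-Valid⁻ (⋀-IsInf g)

-- Den is a relation because infima and suprema in 𝟛 cannot be computed constructively; under
-- excluded middle they exist, and Den becomes the graph of the denotation function ⟦_⟧.
module Semantics (em : ExcludedMiddle (Level.suc 0ℓ)) (μ : Model) where

  private
    em₀ = em-lower em
    S = top μ
    P = Pt S
    V = Val μ

  _≐₃_ : V → V → 𝟛
  a ≐₃ b with em₀ {a ≡ b}
  ... | yes _ = 𝐭
  ... | no _  = 𝐟

  ≐₃-EqVal : ∀ a b → EqVal μ a b (a ≐₃ b)
  ≐₃-EqVal a b with em₀ {a ≡ b}
  ... | yes a≡b = inj₁ (a≡b , refl)
  ... | no a≢b  = inj₂ (a≢b , refl)

  EqVal-functional : ∀ {a b x y} → EqVal μ a b x → EqVal μ a b y → x ≡ y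
  EqVal-functional (inj₁ (_ , refl))   (inj₁ (_ , refl))   = refl
  EqVal-functional (inj₁ (a≡b , _))    (inj₂ (a≢b , _))    = contradiction a≡b a≢b
  EqVal-functional (inj₂ (a≢b , _))    (inj₁ (a≡b , _))    = contradiction a≡b a≢b
  EqVal-functional (inj₂ (_ , refl))   (inj₂ (_ , refl))   = refl

  ⟦_⟧ : Formula V → P → 𝟛
  ⟦ atom R a ⟧ p         = ς μ R p a
  ⟦ a ≐ b ⟧ _            = a ≐₃ b
  ⟦ ¬' φ ⟧ p             = ¬₃ ⟦ φ ⟧ p
  ⟦ φ ∧' ψ ⟧ p           = ⟦ φ ⟧ p ∧₃ ⟦ ψ ⟧ p
  ⟦ φ ∨' ψ ⟧ p           = ⟦ φ ⟧ p ∨₃ ⟦ ψ ⟧ p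
  ⟦ φ →w' ψ ⟧ p          = ⟦ φ ⟧ p →w ⟦ ψ ⟧ p
  ⟦ T' φ ⟧ p             = T₃ (⟦ φ ⟧ p)
  ⟦ B' φ ⟧ p             = B₃ (⟦ φ ⟧ p)
  ⟦ TF' φ ⟧ p            = TF₃ (⟦ φ ⟧ p)
  ⟦ Everywhere φ ⟧ _     = ⋀ em₀ ⟦ φ ⟧
  ⟦ Somewhere φ ⟧ _      = ⋁ em₀ ⟦ φ ⟧
  ⟦ Quorum φ ⟧ _         = ⋁ em λ O → ⋀ em₀ λ (m : Mem S O) → ⟦ φ ⟧ (proj₁ m)
  ⟦ Contraquorum φ ⟧ _   = ⋀ em λ O → ⋁ em₀ λ (m : Mem S O) → ⟦ φ ⟧ (proj₁ m)
  ⟦ ∀' φ ⟧ p             = ⋀ em₀ λ a → ⟦ φ a ⟧ p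
  ⟦ ∃' φ ⟧ p             = ⋁ em₀ λ a → ⟦ φ a ⟧ p
  ⟦ ∃01' φ ⟧ p           = ⋀ em₀ λ ab →
    (⟦ φ (proj₁ ab) ⟧ p ∧₃ ⟦ φ (proj₂ ab) ⟧ p) →w (proj₁ ab ≐₃ proj₂ ab)

  ⟦⟧-Den : ∀ φ p → Den μ φ p (⟦ φ ⟧ p)
  ⟦⟧-Den (atom R a) p       = lift refl
  ⟦⟧-Den (a ≐ b) p          = lift (≐₃-EqVal a b)
  ⟦⟧-Den (¬' φ) p           = _ , ⟦⟧-Den φ p , lift refl
  ⟦⟧-Den (φ ∧' ψ) p         = _ , _ , ⟦⟧-Den φ p , ⟦⟧-Den ψ p , lift refl
  ⟦⟧-Den (φ ∨' ψ) p         = _ , _ , ⟦⟧-Den φ p , ⟦⟧-Den ψ p , lift refl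
  ⟦⟧-Den (φ →w' ψ) p        = _ , _ , ⟦⟧-Den φ p , ⟦⟧-Den ψ p , lift refl
  ⟦⟧-Den (T' φ) p           = _ , ⟦⟧-Den φ p , lift refl
  ⟦⟧-Den (B' φ) p           = _ , ⟦⟧-Den φ p , lift refl
  ⟦⟧-Den (TF' φ) p          = _ , ⟦⟧-Den φ p , lift refl
  ⟦⟧-Den (Everywhere φ) p   = ⟦ φ ⟧ , ⟦⟧-Den φ , lift (⋀-IsInf em₀ ⟦ φ ⟧)
  ⟦⟧-Den (Somewhere φ) p    = ⟦ φ ⟧ , ⟦⟧-Den φ , lift (⋁-IsSup em₀ ⟦ φ ⟧)
  ⟦⟧-Den (Quorum φ) p       =
    ⟦ φ ⟧ , ⟦⟧-Den φ , _ , (λ O → ⋀-IsInf em₀ _) , ⋁-IsSup em _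
  ⟦⟧-Den (Contraquorum φ) p =
    ⟦ φ ⟧ , ⟦⟧-Den φ , _ , (λ O → ⋁-IsSup em₀ _) , ⋀-IsInf em _
  ⟦⟧-Den (∀' φ) p           = _ , (λ a → ⟦⟧-Den (φ a) p) , lift (⋀-IsInf em₀ _)
  ⟦⟧-Den (∃' φ) p           = _ , (λ a → ⟦⟧-Den (φ a) p) , lift (⋁-IsSup em₀ _)
  ⟦⟧-Den (∃01' φ) p         =
    _ , (λ a → ⟦⟧-Den (φ a) p) , _≐₃_ , ≐₃-EqVal , lift (⋀-IsInf em₀ _)

  Den-functional : ∀ φ {p x} → Den μ φ p x → x ≡ ⟦ φ ⟧ p
  Den-functional (atom R a) (lift ς≡x) = sym ς≡x
  Den-functional (a ≐ b) (lift eq) = EqVal-functional eq (≐₃-EqVal a b)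
  Den-functional (¬' φ) (_ , d , lift refl) = cong ¬₃_ (Den-functional φ d)
  Den-functional (φ ∧' ψ) (_ , _ , d , e , lift refl) =
    cong₂ _∧₃_ (Den-functional φ d) (Den-functional ψ e)
  Den-functional (φ ∨' ψ) (_ , _ , d , e , lift refl) =
    cong₂ _∨₃_ (Den-functional φ d) (Den-functional ψ e)
  Den-functional (φ →w' ψ) (_ , _ , d , e , lift refl) =
    cong₂ _→w_ (Den-functional φ d) (Den-functional ψ e)
  Den-functional (T' φ) (_ , d , lift refl) = cong T₃ (Den-functional φ d)
  Den-functional (B' φ) (_ , d , lift refl) = cong B₃ (Den-functional φ d)
  Den-functional (TF' φ) (_ , d , lift refl) = cong TF₃ (Den-functional φ d)
  Den-functional (Everywhere φ) (_ , d , lift inf) =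
    IsInf-unique (λ q → Den-functional φ (d q)) inf (⋀-IsInf em₀ _)
  Den-functional (Somewhere φ) (_ , d , lift sup) =
    IsSup-unique (λ q → Den-functional φ (d q)) sup (⋁-IsSup em₀ _)
  Den-functional (Quorum φ) (_ , d , _ , inf , sup) =
    IsSup-unique (λ O → IsInf-unique (λ m → Den-functional φ (d (proj₁ m))) (inf O) (⋀-IsInf em₀ _))
      sup (⋁-IsSup em _)
  Den-functional (Contraquorum φ) (_ , d , _ , sup , inf) =
    IsInf-unique (λ O → IsSup-unique (λ m → Den-functional φ (d (proj₁ m))) (sup O) (⋁-IsSup em₀ _))
      inf (⋀-IsInf em _)
  Den-functional (∀' φ) (_ , d , lift inf) =
    IsInf-unique (λ a → Den-functional (φ a) (d a)) inf (⋀-IsInf em₀ _)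
  Den-functional (∃' φ) (_ , d , lift sup) =
    IsSup-unique (λ a → Den-functional (φ a) (d a)) sup (⋁-IsSup em₀ _)
  Den-functional (∃01' φ) (_ , d , _ , eq , lift inf) =
    IsInf-unique (λ ab → cong₂ _→w_
        (cong₂ _∧₃_ (Den-functional (φ (proj₁ ab)) (d (proj₁ ab)))
                    (Den-functional (φ (proj₂ ab)) (d (proj₂ ab))))
        (EqVal-functional (eq (proj₁ ab) (proj₂ ab)) (≐₃-EqVal (proj₁ ab) (proj₂ ab))))
      inf (⋀-IsInf em₀ _)

  ⊨⇒Valid : ∀ φ → ⊨_ μ φ → ∀ p → Valid (⟦ φ ⟧ p)
  ⊨⇒Valid φ ⊨φ p = ⊨φ p _ (⟦⟧-Den φ p)

  Valid⇒⊨ : ∀ φ → (∀ p → Valid (⟦ φ ⟧ p)) → ⊨_ μ φ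
  Valid⇒⊨ φ valid p x d = subst Valid (sym (Den-functional φ d)) (valid p)

  ≐₃-Valid : ∀ {a b} → Valid (a ≐₃ b) → a ≡ b
  ≐₃-Valid {a} {b} v with em₀ {a ≡ b}
  ... | yes a≡b = a≡b
  ... | no _    = contradiction v ¬Valid-𝐟

  ∃01-Valid : ∀ φ p {a b} → Valid (⟦ ∃01' φ ⟧ p) → ⟦ φ a ⟧ p ≡ 𝐭 → ⟦ φ b ⟧ p ≡ 𝐭 → a ≡ b
  ∃01-Valid _ _ {a} {b} v φa≡𝐭 φb≡𝐭 =
    ≐₃-Valid (Valid-→w-mp (cong₂ _∧₃_ φa≡𝐭 φb≡𝐭) (⋀-Valid⁻ em₀ v (a , b)))

  Quorum-Valid⁻ : ∀ φ p → Valid (⟦ Quorum φ ⟧ p) →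
    Σ (NEOpen S) λ O → ∀ (m : Mem S O) → Valid (⟦ φ ⟧ (proj₁ m))
  Quorum-Valid⁻ _ _ v = let (O , vO) = ⋁-Valid⁻ em v in O , ⋀-Valid⁻ em₀ vO

  Quorum-𝐭 : ∀ φ p (O : NEOpen S) → (∀ (m : Mem S O) → ⟦ φ ⟧ (proj₁ m) ≡ 𝐭) →
    ⟦ Quorum φ ⟧ p ≡ 𝐭
  Quorum-𝐭 _ _ O all𝐭 = ⋁-𝐭 em O (⋀-𝐭 em₀ all𝐭)

  CorrectAt : Sym → P → Set
  CorrectAt R p = ∀ a → ς μ R p a ≢ 𝐛

  correct-Valid⁻ : ∀ R p → Valid (⟦ correct R ⟧ p) → CorrectAt R p
  correct-Valid⁻ R p v a = Valid-TF₃⁻ _ (⋀-Valid⁻ em₀ v a)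

  incorrect-Valid⁻ : ∀ R p → Valid (⟦ incorrect R ⟧ p) → ∀ a → ς μ R p a ≡ 𝐛
  incorrect-Valid⁻ R p v a = Valid-B₃⁻ _ (⋀-Valid⁻ em₀ v a)

  Quorum-correct-Valid⁻ : ∀ R p → Valid (⟦ Quorum (correct R) ⟧ p) →
    Σ (NEOpen S) λ O → ∀ (m : Mem S O) → CorrectAt R (proj₁ m)
  Quorum-correct-Valid⁻ R p v =
    let (O , vO) = Quorum-Valid⁻ (correct R) p v in O , λ m → correct-Valid⁻ R _ (vO m)

module BrachaBroadcast (em : ExcludedMiddle (Level.suc 0ℓ)) (μ : Model) (thy : ThyBB μ) where

  open Semantics em μ
  open ThyBB thy

  private
    em₀ = em-lower em
    P = Pt (top μ)
    V = Val μ

  Broadcast : V → Set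
  Broadcast a = ∃ λ q → ς μ broadcast q a ≡ 𝐭

  CorrectQuorum : Sym → Set₁
  CorrectQuorum R = Σ (NEOpen (top μ)) λ O → ∀ (m : Mem (top μ) O) → CorrectAt R (proj₁ m)

  correct-quorums : P → CorrectQuorum ready × CorrectQuorum echo
  correct-quorums p =
    let (ready-quorum , echo-quorum) = Valid-∧⁻ _ _
          (⊨⇒Valid (Quorum (correct ready) ∧' Quorum (correct echo)) BrCorrect p)
    in Quorum-correct-Valid⁻ ready p ready-quorum , Quorum-correct-Valid⁻ echo p echo-quorum

  broadcast-correct : ∀ {v} → Broadcast v → ∀ q → CorrectAt broadcast q
  broadcast-correct (q₀ , bc≡𝐭) q
    with Valid-∨⁻ _ _ (⊨⇒Valid (Everywhere (correct broadcast) ∨' Everywhere (incorrect broadcast))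
                               BrCorrect'' q₀)
  ... | inj₁ all-correct   = correct-Valid⁻ broadcast q (⋀-Valid⁻ em₀ all-correct q)
  ... | inj₂ all-incorrect
    with trans (sym bc≡𝐭) (incorrect-Valid⁻ broadcast q₀ (⋀-Valid⁻ em₀ all-incorrect q₀) _)
  ... | ()

  broadcast-unique : ∀ {a b} → Broadcast a → Broadcast b → a ≡ b
  broadcast-unique (q , bc-a≡𝐭) (q' , bc-b≡𝐭) =
    ∃01-Valid (λ a → Somewhere (atom broadcast a)) q at-most-one (⋁-𝐭 em₀ q bc-a≡𝐭) (⋁-𝐭 em₀ q' bc-b≡𝐭)
    where
    at-most-one : Valid (⟦ ∃01' (λ a → Somewhere (atom broadcast a)) ⟧ q)
    at-most-one = proj₁ (Valid-∧⁻ _ _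
      (⊨⇒Valid (∃1' λ a → Somewhere (atom broadcast a)) BrBroadcast1 q))

  module _ {v} (broadcast-v : Broadcast v) where

    Valid-broadcast⇒Broadcast : ∀ {q a} → Valid (ς μ broadcast q a) → Broadcast a
    Valid-broadcast⇒Broadcast {q} {a} valid =
      q , Valid∧≢𝐛⇒≡𝐭 valid (broadcast-correct broadcast-v q a)

    echo-if-correct : ∀ p → CorrectAt echo p → ς μ echo p v ≡ 𝐭
    echo-if-correct p correct =
      let (a , echo-a) = ⋁-Valid⁻ em₀ (Valid-→w-mp (⋁-𝐭 em₀ _ (proj₂ broadcast-v))
            (⊨⇒Valid (Somewhere (atom broadcast v) →w' ∃' (atom echo)) (BrEcho! v) p))
          echo-a≡𝐭 = Valid∧≢𝐛⇒≡𝐭 echo-a (correct a)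
          (_ , broadcast-a) = ⋁-Valid⁻ em₀ (Valid-→w-mp echo-a≡𝐭
            (⊨⇒Valid (atom echo a →w' Somewhere (atom broadcast a)) (BrEcho? a) p))
          a≡v = broadcast-unique (Valid-broadcast⇒Broadcast broadcast-a) broadcast-v
      in subst (λ b → ς μ echo p b ≡ 𝐭) a≡v echo-a≡𝐭

    ready-everywhere : ∀ p → Valid (ς μ ready p v)
    ready-everywhere p =
      let (O , echo-correct) = proj₂ (correct-quorums p)
          echo-quorum = Quorum-𝐭 (atom echo v) p O (λ m → echo-if-correct _ (echo-correct m))
      in Valid-→w-mp echo-quorum
           (⊨⇒Valid (Quorum (atom echo v) →w' atom ready v) (BrReady! v) p)

    deliver-everywhere : ∀ p → Valid (ς μ deliver p v)
    deliver-everywhere p =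
      let (O , ready-correct) = proj₁ (correct-quorums p)
          ready-quorum = Quorum-𝐭 (atom ready v) p O
            (λ m → Valid∧≢𝐛⇒≡𝐭 (ready-everywhere _) (ready-correct m v))
      in Valid-→w-mp ready-quorum
           (⊨⇒Valid (Quorum (atom ready v) →w' atom deliver v) (BrDeliver! v) p)

  broadcast⇒deliver : ∀ v → ⊨_ μ (Somewhere (atom broadcast v) →w' Everywhere (atom deliver v))
  broadcast⇒deliver v = Valid⇒⊨ (Somewhere (atom broadcast v) →w' Everywhere (atom deliver v)) λ _ →
    [ (λ broadcast-v → Valid-→w-consequent _ (⋀-Valid em₀ (deliver-everywhere broadcast-v)))
    , (λ ¬broadcast-v → Valid-→w-antecedent _ (⋁-≢𝐭 em₀ λ q bc≡𝐭 → ¬broadcast-v (q , bc≡𝐭)))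
    ]′ (toSum (em₀ {Broadcast v}))

proposition4p15 : ExcludedMiddle (Level.suc 0ℓ) →
    (μ : Model) → ThreeTwined (top μ) → ThyBB μ →
    (v : Val μ) →
    ⊨_ μ (Somewhere (atom broadcast v) →w' Everywhere (atom deliver v))
proposition4p15 em μ _ thy = BrachaBroadcast.broadcast⇒deliver em μ thy
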